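{- Consider graphs without isolated vertices and without $K_2$ components. (i) There is no such graph $G$ of order $n>6$ such that $D_k^t(G)\cong C_m$ for some integers $k$ and $m\geq 3$. (ii) For $m>10$, there is no such graph $G$ such that $D_k^t(G)\cong C_m$ for some integer $k$.
   Context: $C_m$ is the cycle on $m$ vertices. A total dominating set (TDS) of a graph without isolated vertices is a vertex set $S$ such that every vertex is adjacent to a vertex of $S$. For a positive integer $k$, $D_k^t(G)$ is the graph whose vertices are the TDSs of $G$ of cardinality at most $k$, two being adjacent if and only if one is obtained from the other by adding or deleting a single vertex. -}

module Defs where

open import Data.Nat using (ℕ; zero; suc; _≤_; _<_)
open import Data.Fin using (Fin; toℕ)
open import Data.Fin.Subset using (Subset; _∈_; _∉_; ⁅_⁆; _∪_; ∣_∣)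
open import Data.Product using (Σ; _×_; ∃-syntax)
open import Data.Sum using (_⊎_)
open import Relation.Nullary using (¬_)
open import Relation.Binary.PropositionalEquality using (_≡_)

record Graph (n : ℕ) : Set₁ where
  field
    Adj   : Fin n → Fin n → Set
    sym   : ∀ {u v} → Adj u v → Adj v u
    irrefl : ∀ {u} → ¬ Adj u u
open Graph public

NoIsolated : ∀ {n} → Graph n → Set
NoIsolated {n} G = ∀ (v : Fin n) → ∃[ u ] Adj G v u

NoK2Component : ∀ {n} → Graph n → Set
NoK2Component {n} G =
  ∀ (u v : Fin n) → Adj G u v →
    ¬ ((∀ w → Adj G u w → w ≡ v) × (∀ w → Adj G v w → w ≡ u))

IsTDS : ∀ {n} → Graph n → Subset n → Set
IsTDS {n} G S = ∀ (v : Fin n) → ∃[ u ] (u ∈ S × Adj G v u)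

IsDkVertex : ∀ {n} → Graph n → ℕ → Subset n → Set
IsDkVertex G k S = IsTDS G S × ∣ S ∣ ≤ k

AddOne : ∀ {n} → Subset n → Subset n → Set
AddOne S T = ∃[ v ] (v ∉ S × T ≡ S ∪ ⁅ v ⁆)

DkAdj : ∀ {n} → Subset n → Subset n → Set
DkAdj S T = AddOne S T ⊎ AddOne T S

CycleAdj : (m : ℕ) → Fin m → Fin m → Set
CycleAdj m i j =
  (toℕ j ≡ suc (toℕ i)) ⊎ (toℕ i ≡ suc (toℕ j)) ⊎
  ((toℕ j ≡ 0 × suc (toℕ i) ≡ m) ⊎ (toℕ i ≡ 0 × suc (toℕ j) ≡ m))

DkIsoCycle : ∀ {n} → Graph n → ℕ → ℕ → Set
DkIsoCycle {n} G k m =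
  Σ (Fin m → Subset n) λ f →
    (∀ i → IsDkVertex G k (f i)) ×
    (∀ i j → f i ≡ f j → i ≡ j) ×
    (∀ S → IsDkVertex G k S → ∃[ i ] f i ≡ S) ×
    (∀ i j → (DkAdj (f i) (f j) → CycleAdj m i j) × (CycleAdj m i j → DkAdj (f i) (f j)))

module Submission where

open import Defs
open import Data.Nat using (ℕ; _<_; _≤_)
open import Data.Product using (_×_)
open import Relation.Nullary using (¬_)

open import Level using (0ℓ)
open import Data.Empty using () renaming (⊥ to Empty)
open import Data.Unit using (tt)
open import Data.Nat using (zero; suc; _+_; _≤?_; s≤s; z≤n)
open import Data.Nat.Properties as ℕ using (≤-trans; ≤-pred; n≤1+n; +-suc)
open import Data.Fin using (Fin; zero; suc; toℕ; fromℕ<; inject≤; _≟_)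
open import Data.Fin.Properties
  using (∀-cons; injective⇒≤; inject≤-injective; 0≢1+n; suc-injective; toℕ-injective; toℕ<n; toℕ-fromℕ<)
open import Data.Fin.Subset using (Subset; inside; outside; ⊥; _∈_; _∉_; ⁅_⁆; _∪_; _-_; ∁; ∣_∣; _⊆_)
open import Data.Fin.Subset.Properties
  using (_∈?_; ∣p∣≤n; ∣∁p∣≡n∸∣p∣; ∣⁅x⁆∣≡1; ∣p─q∣≤∣p∣; ∪-identityʳ; p⊆p∪q; x∈p∪q⁺; x∈p∪q⁻; x∈⁅x⁆;
         x∈⁅y⁆⇒x≡y; x≢y⇒x∉⁅y⁆; x∈∁p⇒x∉p; x∉p⇒x∈∁p; ⊆-antisym; p─q⊆p; x∈p∧x≢y⇒x∈p-y; ∉⊥)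
open import Data.Vec.Base using (_∷_; here; there)
open import Data.Product using (Σ; ∃; _,_; proj₁; proj₂)
open import Data.Sum as Sum using (_⊎_; inj₁; inj₂)
open import Function using (_∘_)
open import Relation.Nullary using (Dec; yes; no)
open import Relation.Nullary.Decidable using (¬¬-excluded-middle)
open import Relation.Nullary.Negation using (¬¬-Monad; contradiction)
open import Relation.Unary using (Pred; U; _∩_; Decidable) renaming (∁ to Not)
open import Relation.Binary.PropositionalEquality as ≡ using (_≡_; _≢_; refl; trans; cong; subst)
open import Effect.Monad using (RawMonad)
open RawMonad (¬¬-Monad {0ℓ})

-- Let D = D_k^t(G) ≅ C_m.  Everything rests on one fact:
-- D has maximum degree two.  Adding a vertex to a small TDS, or deleting a
-- vertex from a vertex of D while keeping total domination, gives neighbours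
-- in D; so a TDS S with ∣ S ∣ < k misses at most two vertices (n ≤ ∣ S ∣ + 2),
-- any edge of D gives n ≤ k + 1, and one endpoint of every edge of D is a
-- co-singleton ∁ ⁅ x ⁆.  Once n ≤ k + 1, every proper TDS lies in D, and:
--   * without leaves (n ≥ 6) every ∁ ⁅ x ⁆ is a TDS, three deletions
--     ∁ ⁅ x ⁆ - y fail, and each failure yields a vertex with neighbourhood
--     {x, y}; applied twice this gives a vertex with three neighbours inside a
--     two-element set;
--   * with a leaf l of p (n ≥ 7) the same failures produce leaves at two more
--     support vertices, and deleting three leaves with distinct supports leaves
--     a TDS that misses three vertices.
-- For m ≥ 11 the co-singleton vertices of D cover C_m, hence number at least
-- six; as they avoid every support vertex, this forces the order needed above.

¬¬-∀-Fin : ∀ {n} {P : Fin n → Set} → (∀ i → ¬ ¬ P i) → ¬ ¬ (∀ i → P i)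
¬¬-∀-Fin {zero} _ = pure λ ()
¬¬-∀-Fin {suc n} h = do
  p₀ ← h zero
  ps ← ¬¬-∀-Fin (λ i → h (suc i))
  pure (∀-cons p₀ ps)

drop-left : ∀ {A B : Set} → ¬ A → A ⊎ B → B
drop-left ¬a (inj₁ a) = contradiction a ¬a
drop-left ¬a (inj₂ b) = b

drop-right : ∀ {A B : Set} → ¬ B → A ⊎ B → A
drop-right ¬b (inj₁ a) = a
drop-right ¬b (inj₂ b) = contradiction b ¬b

record Distinct {A : Set} (r : ℕ) (Q : Pred A 0ℓ) : Set where
  constructor distinct
  field
    pick           : Fin r → A
    pick-injective : ∀ {s t} → pick s ≡ pick t → s ≡ t
    pick-sat       : ∀ t → Q (pick t)
open Distinct public

module _ {A : Set} {Q R : Pred A 0ℓ} where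

  weaken : ∀ {r} → (∀ {x} → Q x → R x) → Distinct r Q → Distinct r R
  weaken Q⊆R D = distinct (pick D) (pick-injective D) (λ t → Q⊆R (pick-sat D t))

module _ {A : Set} {Q : Pred A 0ℓ} where

  none : Distinct 0 Q
  none = distinct (λ ()) (λ { {()} }) (λ ())

  cons : ∀ {r} (x : A) → Q x → (D : Distinct r Q) → (∀ t → pick D t ≢ x) → Distinct (suc r) Q
  cons {r} x qx D new = distinct p p-inj p-sat
    where
    p : Fin (suc r) → A
    p zero    = x
    p (suc t) = pick D t
    p-inj : ∀ {s t} → p s ≡ p t → s ≡ t
    p-inj {zero}  {zero}  _ = refl
    p-inj {zero}  {suc t} e = contradiction (≡.sym e) (new t)
    p-inj {suc s} {zero}  e = contradiction e (new s)
    p-inj {suc s} {suc t} e = cong suc (pick-injective D e)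
    p-sat : ∀ t → Q (p t)
    p-sat zero    = qx
    p-sat (suc t) = pick-sat D t

  pair : ∀ {x y} → x ≢ y → Q x → Q y → Distinct 2 Q
  pair {x} {y} x≢y qx qy = cons x qx (cons y qy none λ ()) λ { zero e → x≢y (≡.sym e) }

  tail : ∀ {r} (D : Distinct (suc r) Q) → Distinct r (λ y → Q y × y ≢ pick D zero)
  tail D = distinct (λ t → pick D (suc t)) (λ e → suc-injective (pick-injective D e))
                    (λ t → pick-sat D (suc t) , λ e → 0≢1+n (≡.sym (pick-injective D e)))

  shrink : ∀ {r s} → r ≤ s → Distinct s Q → Distinct r Q
  shrink r≤s D = distinct (λ t → pick D (inject≤ t r≤s))
                          (λ e → inject≤-injective r≤s r≤s _ _ (pick-injective D e))
                          (λ t → pick-sat D (inject≤ t r≤s))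

  distinct-picks : ∀ {r} (D : Distinct r Q) {s t} → s ≢ t → pick D s ≢ pick D t
  distinct-picks D s≢t e = s≢t (pick-injective D e)

module _ {A B : Set} {Q : Pred A 0ℓ} {R : Pred B 0ℓ} where

  mapDistinct : ∀ {r} (φ : ∀ x → Q x → B) →
                (∀ {x y} (qx : Q x) (qy : Q y) → φ x qx ≡ φ y qy → x ≡ y) →
                (∀ x (qx : Q x) → R (φ x qx)) → Distinct r Q → Distinct r R
  mapDistinct φ φ-inj φ-sat D = distinct
    (λ t → φ (pick D t) (pick-sat D t))
    (λ e → pick-injective D (φ-inj _ _ e))
    (λ t → φ-sat _ _)

Distinct⇒≤ : ∀ {n r} {Q : Pred (Fin n) 0ℓ} → Distinct r Q → r ≤ n
Distinct⇒≤ D = injective⇒≤ (pick-injective D)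

allOf : ∀ {n} → Distinct {Fin n} n U
allOf = distinct (λ t → t) (λ e → e) (λ _ → tt)

atMostTwo : ∀ {A : Set} {Q C₁ C₂ : Pred A 0ℓ} → (∀ {x} → Q x → C₁ x ⊎ C₂ x) →
            (∀ {x y} → C₁ x → C₁ y → x ≡ y) → (∀ {x y} → C₂ x → C₂ y → x ≡ y) →
            ¬ Distinct 3 Q
atMostTwo {A} {Q} {C₁} {C₂} classify C₁-unique C₂-unique D
  with Distinct⇒≤ (mapDistinct {R = U} class class-injective (λ _ _ → tt) D)
  where
  classOf : ∀ {x} → C₁ x ⊎ C₂ x → Fin 2
  classOf (inj₁ _) = zero
  classOf (inj₂ _) = suc zero
  class : ∀ x → Q x → Fin 2
  class _ qx = classOf (classify qx)
  sameClass : ∀ {x y} (cx : C₁ x ⊎ C₂ x) (cy : C₁ y ⊎ C₂ y) → classOf cx ≡ classOf cy → x ≡ y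
  sameClass (inj₁ c) (inj₁ c′) _ = C₁-unique c c′
  sameClass (inj₂ c) (inj₂ c′) _ = C₂-unique c c′
  sameClass (inj₁ _) (inj₂ _) ()
  sameClass (inj₂ _) (inj₁ _) ()
  class-injective : ∀ {x y} (qx : Q x) (qy : Q y) → class x qx ≡ class y qy → x ≡ y
  class-injective qx qy = sameClass (classify qx) (classify qy)
... | s≤s (s≤s ())

noThreeInPair : ∀ {A : Set} {a b : A} → ¬ Distinct 3 (λ x → x ≡ a ⊎ x ≡ b)
noThreeInPair = atMostTwo (λ q → q) (λ { refl refl → refl }) (λ { refl refl → refl })

forget : ∀ {A : Set} (Q R : Pred A 0ℓ) {x y : A} → (Q y × y ≢ x) × R y → Q y × R y
forget Q R ((qy , _) , ry) = qy , ry

module _ {A : Set} {P : Pred A 0ℓ} where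

  partition : ∀ {s} {Q : Pred A 0ℓ} → Decidable P → Distinct s Q →
              Σ ℕ λ a → Σ ℕ λ b → a + b ≡ s × Distinct a (Q ∩ P) × Distinct b (Q ∩ Not P)
  partition {zero} P? D = 0 , 0 , refl , none , none
  partition {suc s} {Q} P? D with partition P? (tail D) | P? (pick D zero)
  ... | a , b , a+b≡s , DP , D¬P | yes px =
    suc a , b , cong suc a+b≡s ,
    cons x (pick-sat D zero , px) (weaken (forget Q P) DP) (λ t → proj₂ (proj₁ (pick-sat DP t))) ,
    weaken (forget Q (Not P)) D¬P
    where x = pick D zero
  ... | a , b , a+b≡s , DP , D¬P | no ¬px =
    a , suc b , trans (+-suc a b) (cong suc a+b≡s) ,
    weaken (forget Q P) DP ,
    cons x (pick-sat D zero , ¬px) (weaken (forget Q (Not P)) D¬P) (λ t → proj₂ (proj₁ (pick-sat D¬P t)))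
    where x = pick D zero

  pigeonhole : ∀ {r s t} {Q : Pred A 0ℓ} → t + r ≤ suc s → Decidable P → Distinct s Q →
               ¬ Distinct r (Q ∩ P) → Distinct t (Q ∩ Not P)
  pigeonhole {r} {s} {t} t+r≤1+s P? D few with partition P? D
  ... | a , b , a+b≡s , DP , D¬P with r ≤? a
  ...   | yes r≤a = contradiction (shrink r≤a DP) few
  ...   | no r≰a = shrink t≤b D¬P
    where
    t≤b : t ≤ b
    t≤b = ℕ.+-cancelʳ-≤ a t b (ℕ.≤-pred (begin
      suc (t + a)  ≡⟨ +-suc t a ⟨
      t + suc a    ≤⟨ ℕ.+-monoʳ-≤ t (ℕ.≰⇒> r≰a) ⟩
      t + r        ≤⟨ t+r≤1+s ⟩
      suc s        ≡⟨ cong suc (trans (≡.sym a+b≡s) (ℕ.+-comm a b)) ⟩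
      suc (b + a)  ∎))
      where open ℕ.≤-Reasoning

∣p∪⁅x⁆∣ : ∀ {n} (p : Subset n) {x} → x ∉ p → ∣ p ∪ ⁅ x ⁆ ∣ ≡ suc ∣ p ∣
∣p∪⁅x⁆∣ (outside ∷ p) {zero}  _   = cong (suc ∘ ∣_∣) (∪-identityʳ p)
∣p∪⁅x⁆∣ (inside  ∷ p) {zero}  x∉p = contradiction here x∉p
∣p∪⁅x⁆∣ (outside ∷ p) {suc x} x∉p = ∣p∪⁅x⁆∣ p (x∉p ∘ there)
∣p∪⁅x⁆∣ (inside  ∷ p) {suc x} x∉p = cong suc (∣p∪⁅x⁆∣ p (x∉p ∘ there))

∉-∪⁅⁆ : ∀ {n} {p : Subset n} {x y} → y ∉ p → y ≢ x → y ∉ p ∪ ⁅ x ⁆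
∉-∪⁅⁆ {p = p} {x} y∉p y≢x y∈ with x∈p∪q⁻ p ⁅ x ⁆ y∈
... | inj₁ y∈p = y∉p y∈p
... | inj₂ y∈x = y≢x (x∈⁅y⁆⇒x≡y x y∈x)

x∉p-x : ∀ {n} (p : Subset n) (x : Fin n) → x ∉ p - x
x∉p-x (_ ∷ p) zero    ()
x∉p-x (_ ∷ p) (suc x) (there x∈) = x∉p-x p x x∈

∈-remove⁻ : ∀ {n} {p : Subset n} {x y} → y ∈ p - x → y ∈ p × y ≢ x
∈-remove⁻ {p = p} {x} y∈ = p─q⊆p p ⁅ x ⁆ y∈ , λ { refl → x∉p-x p x y∈ }

p-x∪⁅x⁆ : ∀ {n} {p : Subset n} {x} → x ∈ p → (p - x) ∪ ⁅ x ⁆ ≡ p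
p-x∪⁅x⁆ {p = p} {x} x∈p = ⊆-antisym to from
  where
  to : (p - x) ∪ ⁅ x ⁆ ⊆ p
  to y∈ with x∈p∪q⁻ (p - x) ⁅ x ⁆ y∈
  ... | inj₁ y∈p-x = proj₁ (∈-remove⁻ y∈p-x)
  ... | inj₂ y∈x   = subst (_∈ p) (≡.sym (x∈⁅y⁆⇒x≡y x y∈x)) x∈p
  from : p ⊆ (p - x) ∪ ⁅ x ⁆
  from {y} y∈p with y ≟ x
  ... | yes refl = x∈p∪q⁺ (inj₂ (x∈⁅x⁆ x))
  ... | no y≢x   = x∈p∪q⁺ (inj₁ (x∈p∧x≢y⇒x∈p-y y∈p y≢x))

missing-count : ∀ {n r} {p : Subset n} → Distinct r (_∉ p) → r + ∣ p ∣ ≤ n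
missing-count {r = zero}  {p} _ = ∣p∣≤n p
missing-count {n} {suc r} {p} D = subst (_≤ n) (+-suc r ∣ p ∣)
  (subst (λ s → r + s ≤ n) (∣p∪⁅x⁆∣ p x∉p) (missing-count (weaken avoid (tail D))))
  where
  x = pick D zero
  x∉p = pick-sat D zero
  avoid : ∀ {y} → y ∉ p × y ≢ x → y ∉ p ∪ ⁅ x ⁆
  avoid (y∉p , y≢x) = ∉-∪⁅⁆ y∉p y≢x

members : ∀ {n r} (p : Subset n) → r ≤ ∣ p ∣ → Distinct r (_∈ p)
members {n} {r} p r≤∣p∣ with partition (_∈? p) allOf
... | a , b , a+b≡n , Din , Dout = shrink (≤-trans r≤∣p∣ ∣p∣≤a) (weaken proj₂ Din)
  where
  ∣p∣≤a : ∣ p ∣ ≤ a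
  ∣p∣≤a = ℕ.+-cancelˡ-≤ b ∣ p ∣ a
    (subst (b + ∣ p ∣ ≤_) (trans (≡.sym a+b≡n) (ℕ.+-comm a b)) (missing-count (weaken proj₂ Dout)))

missing : ∀ {n r} (p : Subset n) → r + ∣ p ∣ ≤ n → Distinct r (_∉ p)
missing {n} {r} p r+∣p∣≤n = weaken x∈∁p⇒x∉p
  (members (∁ p) (subst (r ≤_) (≡.sym (∣∁p∣≡n∸∣p∣ p)) (ℕ.m+n≤o⇒m≤o∸n r r+∣p∣≤n)))

IsCoSingleton : ∀ {n} → Subset n → Set
IsCoSingleton p = ∃ λ x → p ≡ ∁ ⁅ x ⁆

∈∁⁅⁆ : ∀ {n} {x y : Fin n} → y ≢ x → y ∈ ∁ ⁅ x ⁆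
∈∁⁅⁆ y≢x = x∉p⇒x∈∁p (x≢y⇒x∉⁅y⁆ y≢x)

x∉∁⁅x⁆ : ∀ {n} (x : Fin n) → x ∉ ∁ ⁅ x ⁆
x∉∁⁅x⁆ x x∈ = x∈∁p⇒x∉p x∈ (x∈⁅x⁆ x)

coSingleton : ∀ {n} {p : Subset n} → suc ∣ p ∣ ≡ n → IsCoSingleton p
coSingleton {n} {p} 1+∣p∣≡n = x , ⊆-antisym p⊆∁x ∁x⊆p
  where
  x = pick (missing p (ℕ.≤-reflexive 1+∣p∣≡n)) zero
  x∉p = pick-sat (missing p (ℕ.≤-reflexive 1+∣p∣≡n)) zero
  p⊆∁x : p ⊆ ∁ ⁅ x ⁆
  p⊆∁x {y} y∈p = ∈∁⁅⁆ λ { refl → x∉p y∈p }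
  ∁x⊆p : ∁ ⁅ x ⁆ ⊆ p
  ∁x⊆p {y} y∈∁x with y ∈? p
  ... | yes y∈p = y∈p
  ... | no y∉p  = contradiction (ℕ.≤-trans (missing-count (pair y≢x y∉p x∉p)) (ℕ.≤-reflexive (≡.sym 1+∣p∣≡n)))
                                ℕ.1+n≰n
    where y≢x : y ≢ x
          y≢x refl = x∉∁⁅x⁆ y y∈∁x

outside⇒<n : ∀ {n} {p : Subset n} {x} → x ∉ p → ∣ p ∣ < n
outside⇒<n {n} {p} {x} x∉p = subst (_≤ n) (∣p∪⁅x⁆∣ p x∉p) (∣p∣≤n (p ∪ ⁅ x ⁆))

∪⁅⁆-injective : ∀ {n} {p : Subset n} {x y} → x ∉ p → p ∪ ⁅ x ⁆ ≡ p ∪ ⁅ y ⁆ → x ≡ y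
∪⁅⁆-injective {p = p} {x} {y} x∉p e with x ≟ y
... | yes x≡y = x≡y
... | no x≢y  = contradiction (subst (x ∈_) e (x∈p∪q⁺ (inj₂ (x∈⁅x⁆ x)))) (∉-∪⁅⁆ x∉p x≢y)

remove-injective : ∀ {n} {p : Subset n} {x y} → x ∈ p → p - x ≡ p - y → x ≡ y
remove-injective {p = p} {x} {y} x∈p e with x ≟ y
... | yes x≡y = x≡y
... | no x≢y  = contradiction (subst (x ∈_) (≡.sym e) (x∈p∧x≢y⇒x∈p-y x∈p x≢y)) (x∉p-x p x)

∉∁⁅x⁆-y : ∀ {n} {x y z : Fin n} → z ∉ ∁ ⁅ x ⁆ - y → z ≡ x ⊎ z ≡ y
∉∁⁅x⁆-y {x = x} {y} {z} z∉ with z ≟ x | z ≟ y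
... | yes z≡x | _       = inj₁ z≡x
... | no _    | yes z≡y = inj₂ z≡y
... | no z≢x  | no z≢y  = contradiction (x∈p∧x≢y⇒x∈p-y (∈∁⁅⁆ z≢x) z≢y) z∉

image : ∀ {n r} → (Fin r → Fin n) → Subset n
image {r = zero}  c = ⊥
image {r = suc r} c = ⁅ c zero ⁆ ∪ image (c ∘ suc)

∈image⁺ : ∀ {n r} (c : Fin r → Fin n) i → c i ∈ image c
∈image⁺ c zero    = x∈p∪q⁺ (inj₁ (x∈⁅x⁆ (c zero)))
∈image⁺ c (suc i) = x∈p∪q⁺ (inj₂ (∈image⁺ (c ∘ suc) i))

∈image⁻ : ∀ {n r} (c : Fin r → Fin n) {v} → v ∈ image c → ∃ λ i → v ≡ c i
∈image⁻ {r = zero}  c v∈ = contradiction v∈ ∉⊥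
∈image⁻ {r = suc r} c v∈ with x∈p∪q⁻ ⁅ c zero ⁆ (image (c ∘ suc)) v∈
... | inj₁ v∈c₀ = zero , x∈⁅y⁆⇒x≡y (c zero) v∈c₀
... | inj₂ v∈cs = let i , e = ∈image⁻ (c ∘ suc) v∈cs in suc i , e

Successor : ∀ m → Fin m → Fin m → Set
Successor m i j = toℕ j ≡ suc (toℕ i) ⊎ (toℕ j ≡ 0 × suc (toℕ i) ≡ m)

successor-unique : ∀ {m i j j′} → Successor m i j → Successor m i j′ → j ≡ j′
successor-unique (inj₁ e)       (inj₁ e′)       = toℕ-injective (trans e (≡.sym e′))
successor-unique (inj₂ (z , _)) (inj₂ (z′ , _)) = toℕ-injective (trans z (≡.sym z′))
successor-unique {m} {j = j} (inj₁ e) (inj₂ (_ , i+1≡m)) =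
  contradiction (subst (_< m) (trans e i+1≡m) (toℕ<n j)) (ℕ.<-irrefl refl)
successor-unique {m} {j′ = j′} (inj₂ (_ , i+1≡m)) (inj₁ e′) =
  contradiction (subst (_< m) (trans e′ i+1≡m) (toℕ<n j′)) (ℕ.<-irrefl refl)

predecessor-unique : ∀ {m i j j′} → Successor m j i → Successor m j′ i → j ≡ j′
predecessor-unique (inj₁ e)       (inj₁ e′)       = toℕ-injective (ℕ.suc-injective (trans (≡.sym e) e′))
predecessor-unique (inj₂ (_ , w)) (inj₂ (_ , w′)) = toℕ-injective (ℕ.suc-injective (trans w (≡.sym w′)))
predecessor-unique (inj₁ e)       (inj₂ (z , _))  = contradiction (trans (≡.sym e) z) λ ()
predecessor-unique (inj₂ (z , _)) (inj₁ e′)       = contradiction (trans (≡.sym e′) z) λ ()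

direction : ∀ {m i j} → CycleAdj m i j → Successor m i j ⊎ Successor m j i
direction (inj₁ e)                = inj₁ (inj₁ e)
direction (inj₂ (inj₁ e))         = inj₂ (inj₁ e)
direction (inj₂ (inj₂ (inj₁ w)))  = inj₁ (inj₂ w)
direction (inj₂ (inj₂ (inj₂ w)))  = inj₂ (inj₂ w)

cycleDegree : ∀ {m} (i : Fin m) → ¬ Distinct 3 (CycleAdj m i)
cycleDegree i = atMostTwo direction successor-unique predecessor-unique

CoversPath : Pred ℕ 0ℓ → ℕ → ℕ → Set
CoversPath Q a b = ∀ i → a ≤ i → suc i < b → Q i ⊎ Q (suc i)

Between : ℕ → ℕ → Pred ℕ 0ℓ → Pred ℕ 0ℓ
Between a b Q i = a ≤ i × i < b × Q i

-- A vertex cover of a path on 2r vertices has r distinct elements (one in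
-- each edge of a perfect matching).
pathCover : ∀ (Q : Pred ℕ 0ℓ) r a → CoversPath Q a (a + (r + r)) → Distinct r (Between a (a + (r + r)) Q)
pathCover Q zero    a _     = none
pathCover Q (suc r) a cover = extend (cover a ℕ.≤-refl a+1<end)
  where
  end≡ : a + (suc r + suc r) ≡ suc (suc a) + (r + r)
  end≡ = trans (+-suc a (r + suc r)) (cong suc (trans (cong (a +_) (+-suc r r)) (+-suc a (r + r))))
  a+1<end : suc a < a + (suc r + suc r)
  a+1<end rewrite end≡ = s≤s (s≤s (ℕ.m≤m+n a (r + r)))
  rest : Distinct r (Between (suc (suc a)) (suc (suc a) + (r + r)) Q)
  rest = pathCover Q r (suc (suc a)) λ i 2+a≤i i+1<end →
    cover i (ℕ.≤-trans (ℕ.n≤1+n a) (ℕ.≤-trans (ℕ.n≤1+n (suc a)) 2+a≤i)) (subst (suc i <_) (≡.sym end≡) i+1<end)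
  widen : ∀ {i} → Between (suc (suc a)) (suc (suc a) + (r + r)) Q i → Between a (a + (suc r + suc r)) Q i
  widen {i} (2+a≤i , i<end , qi) =
    ℕ.≤-trans (ℕ.n≤1+n a) (ℕ.≤-trans (ℕ.n≤1+n (suc a)) 2+a≤i) , subst (i <_) (≡.sym end≡) i<end , qi
  beyond : ∀ {h} → h < suc (suc a) → ∀ t → pick rest t ≢ h
  beyond h<2+a t refl = ℕ.<-irrefl refl (ℕ.<-≤-trans h<2+a (proj₁ (pick-sat rest t)))
  extend : Q a ⊎ Q (suc a) → Distinct (suc r) (Between a (a + (suc r + suc r)) Q)
  extend (inj₁ qa)  = cons a (ℕ.≤-refl , ℕ.<-trans (ℕ.n<1+n a) a+1<end , qa) (weaken widen rest)
                        (beyond (ℕ.<-trans (ℕ.n<1+n a) (ℕ.n<1+n (suc a))))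
  extend (inj₂ qa+1) = cons (suc a) (ℕ.n≤1+n a , a+1<end , qa+1) (weaken widen rest) (beyond (ℕ.n<1+n (suc a)))

coversSubpath : ∀ {Q a b a′ b′} → a ≤ a′ → b′ ≤ b → CoversPath Q a b → CoversPath Q a′ b′
coversSubpath a≤a′ b′≤b cover i a′≤i i+1<b′ = cover i (ℕ.≤-trans a≤a′ a′≤i) (ℕ.<-≤-trans i+1<b′ b′≤b)

cycleCoverℕ : ∀ (Q : Pred ℕ 0ℓ) m r → r + r ≤ suc m → CoversPath Q 0 m →
              (∀ l → suc l ≡ m → Q l ⊎ Q 0) → Distinct r Q
cycleCoverℕ Q m zero    _  _    _    = none
cycleCoverℕ Q m (suc r) le path wrap with suc r + suc r ≤? m
... | yes fits    = weaken (proj₂ ∘ proj₂) (pathCover Q (suc r) 0 (coversSubpath z≤n fits path))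
... | no overflow = close (wrap (r + r) odd)
  where
  odd : suc (r + r) ≡ m
  odd = trans (≡.sym (+-suc r r)) (≡.sym (ℕ.≤-antisym (ℕ.≤-pred (ℕ.≰⇒> overflow)) (ℕ.≤-pred le)))
  close : Q (r + r) ⊎ Q 0 → Distinct (suc r) Q
  close (inj₁ q) = cons (r + r) q (weaken (proj₂ ∘ proj₂) P) λ t e → ℕ.<-irrefl e (proj₁ (proj₂ (pick-sat P t)))
    where P = pathCover Q r 0 (coversSubpath z≤n (ℕ.≤-trans (ℕ.n≤1+n _) (ℕ.≤-reflexive odd)) path)
  close (inj₂ q) = cons 0 q (weaken (proj₂ ∘ proj₂) P) λ t e → ℕ.<-irrefl (≡.sym e) (proj₁ (pick-sat P t))
    where P = pathCover Q r 1 (coversSubpath z≤n (ℕ.≤-reflexive odd) path)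

cycleCover : ∀ {m r} (H : Pred (Fin m) 0ℓ) → r + r ≤ suc m →
             (∀ i j → CycleAdj m i j → H i ⊎ H j) → Distinct r H
cycleCover {m} {r} H r+r≤1+m cover =
  mapDistinct {R = H} toFin toFin-injective (λ _ → proj₂) (cycleCoverℕ Hℕ m r r+r≤1+m path wrap)
  where
  Hℕ : Pred ℕ 0ℓ
  Hℕ i = Σ (i < m) λ i<m → H (fromℕ< i<m)
  toFin : ∀ i → Hℕ i → Fin m
  toFin _ (i<m , _) = fromℕ< i<m
  toFin-injective : ∀ {i j} (hi : Hℕ i) (hj : Hℕ j) → toFin i hi ≡ toFin j hj → i ≡ j
  toFin-injective (i<m , _) (j<m , _) e = trans (≡.sym (toℕ-fromℕ< i<m)) (trans (cong toℕ e) (toℕ-fromℕ< j<m))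
  path : CoversPath Hℕ 0 m
  path i _ i+1<m = Sum.map (i<m ,_) (i+1<m ,_)
    (cover _ _ (inj₁ (trans (toℕ-fromℕ< i+1<m) (cong suc (≡.sym (toℕ-fromℕ< i<m))))))
    where i<m = ℕ.<-trans (ℕ.n<1+n i) i+1<m
  wrap : ∀ l → suc l ≡ m → Hℕ l ⊎ Hℕ 0
  wrap l l+1≡m = Sum.map (l<m ,_) (0<m ,_)
    (cover _ _ (inj₂ (inj₂ (inj₁ (toℕ-fromℕ< 0<m , trans (cong suc (toℕ-fromℕ< l<m)) l+1≡m)))))
    where l<m = ℕ.≤-reflexive l+1≡m
          0<m = ℕ.≤-<-trans z≤n l<m

module GraphFacts {n : ℕ} (G : Graph n) where

  infix 4 _~_
  _~_ : Fin n → Fin n → Set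
  _~_ = Adj G

  IsLeafOf : Fin n → Fin n → Set
  IsLeafOf c y = ∀ z → c ~ z → z ≡ y

  Within : Fin n → Fin n → Fin n → Set
  Within w a b = ∀ z → w ~ z → z ≡ a ⊎ z ≡ b

  tds-mono : ∀ {S T} → S ⊆ T → IsTDS G S → IsTDS G T
  tds-mono S⊆T tds v = let u , u∈S , v~u = tds v in u , S⊆T u∈S , v~u

  support∈TDS : ∀ {S c y} → IsLeafOf c y → IsTDS G S → y ∈ S
  support∈TDS {S} {c} leaf tds = let u , u∈S , c~u = tds c in subst (_∈ S) (leaf u c~u) u∈S

  notLeaf : ∀ {c y} → ¬ IsLeafOf c y → ¬ ¬ ∃ λ z → c ~ z × z ≢ y
  notLeaf {c} {y} ¬leaf noOther = ¬leaf leaf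
    where
    leaf : IsLeafOf c y
    leaf z c~z with z ≟ y
    ... | yes z≡y = z≡y
    ... | no z≢y  = contradiction (z , c~z , z≢y) noOther

  undominated : ∀ {S} → ¬ IsTDS G S → ¬ ¬ ∃ λ w → ∀ z → w ~ z → z ∉ S
  undominated {S} ¬tds noneUndominated = ¬¬-∀-Fin dominated ¬tds
    where
    dominated : ∀ v → ¬ ¬ ∃ λ u → u ∈ S × v ~ u
    dominated v ¬dom = noneUndominated (v , λ z v~z z∈S → ¬dom (z , z∈S , v~z))

  module LeafFacts (noIsolated : NoIsolated G) (noK2 : NoK2Component G) where

    leaf-adj : ∀ {c y} → IsLeafOf c y → c ~ y
    leaf-adj {c} leaf = let u , c~u = noIsolated c in subst (c ~_) (leaf u c~u) c~u

    support-unique : ∀ {c y y′} → IsLeafOf c y → IsLeafOf c y′ → y ≡ y′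
    support-unique leaf leaf′ = leaf′ _ (leaf-adj leaf)

    otherNeighbour : ∀ {c y} → IsLeafOf c y → ¬ ¬ ∃ λ z → y ~ z × z ≢ c
    otherNeighbour {c} {y} leaf = notLeaf λ y-leaf → noK2 c y (leaf-adj leaf) (leaf , y-leaf)

    -- Deleting leaves c i with pairwise different supports σ i keeps a TDS:
    -- a support keeps a neighbour that is not one of these leaves.
    leafComplementTDS : ∀ {r} (L : Subset n) (c σ : Fin r → Fin n) →
                        (∀ {v} → v ∈ L → ∃ λ i → v ≡ c i) → (∀ i → IsLeafOf (c i) (σ i)) →
                        (∀ {i j} → σ i ≡ σ j → i ≡ j) → ¬ ¬ IsTDS G (∁ L)
    leafComplementTDS L c σ ∈L⁻ leaves σ-injective = ¬¬-∀-Fin dominated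
      where
      dominated : ∀ v → ¬ ¬ ∃ λ u → u ∈ ∁ L × v ~ u
      dominated v with noIsolated v
      ... | u , v~u with u ∈? L
      ...   | no u∉L  = pure (u , x∉p⇒x∈∁p u∉L , v~u)
      ...   | yes u∈L with ∈L⁻ u∈L
      ...     | i , refl = do
        z , σᵢ~z , z≢cᵢ ← otherNeighbour (leaves i)
        pure (z , x∉p⇒x∈∁p (z∉L σᵢ~z z≢cᵢ) , subst (_~ z) (≡.sym (leaves i v (sym G v~u))) σᵢ~z)
        where
        -- a neighbour of σ i in L is a leaf of σ i, hence it is c i
        z∉L : ∀ {z} → σ i ~ z → z ≢ c i → z ∉ L
        z∉L {z} σᵢ~z z≢cᵢ z∈L with ∈L⁻ z∈L
        ... | j , refl = z≢cᵢ (cong c (σ-injective (≡.sym (leaves j (σ i) (sym G σᵢ~z)))))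

    noLeaf⇒coSingletonTDS : (∀ c y → ¬ IsLeafOf c y) → ∀ x → ¬ ¬ IsTDS G (∁ ⁅ x ⁆)
    noLeaf⇒coSingletonTDS noLeaf x = ¬¬-∀-Fin dominated
      where
      dominated : ∀ v → ¬ ¬ ∃ λ u → u ∈ ∁ ⁅ x ⁆ × v ~ u
      dominated v with noIsolated v
      ... | u , v~u with u ≟ x
      ...   | no u≢x    = pure (u , ∈∁⁅⁆ u≢x , v~u)
      ...   | yes refl = do
        z , v~z , z≢u ← notLeaf (noLeaf v u)
        pure (z , ∈∁⁅⁆ z≢u , v~z)

    nonLeafWithin : ∀ {w a b} → (∀ y → ¬ IsLeafOf w y) → Within w a b → ¬ ¬ (w ~ a × w ~ b)
    nonLeafWithin {w} {a} {b} noLeaf within with noIsolated w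
    ... | u , w~u with within u w~u
    ...   | inj₁ refl = do
      z , w~z , z≢a ← notLeaf (noLeaf a)
      pure (w~u , subst (w ~_) (drop-left z≢a (within z w~z)) w~z)
    ...   | inj₂ refl = do
      z , w~z , z≢b ← notLeaf (noLeaf b)
      pure (subst (w ~_) (drop-right z≢b (within z w~z)) w~z , w~u)

  blockedVertex : ∀ {x y} → ¬ IsTDS G (∁ ⁅ x ⁆ - y) → ¬ ¬ ∃ λ w → Within w x y
  blockedVertex ¬tds = do
    w , noNeighbourIn ← undominated ¬tds
    pure (w , λ z w~z → ∉∁⁅x⁆-y (noNeighbourIn z w~z))

module Isomorphic {n : ℕ} (G : Graph n) (noIsolated : NoIsolated G) (noK2 : NoK2Component G)
                  {k m : ℕ} (iso : DkIsoCycle G k m) where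

  open GraphFacts G
  open LeafFacts noIsolated noK2

  f : Fin m → Subset n
  f = proj₁ iso

  f-vertex : ∀ i → IsDkVertex G k (f i)
  f-vertex = proj₁ (proj₂ iso)

  f-injective : ∀ i j → f i ≡ f j → i ≡ j
  f-injective = proj₁ (proj₂ (proj₂ iso))

  f-onto : ∀ S → IsDkVertex G k S → ∃ λ i → f i ≡ S
  f-onto = proj₁ (proj₂ (proj₂ (proj₂ iso)))

  f-adj : ∀ i j → (DkAdj (f i) (f j) → CycleAdj m i j) × (CycleAdj m i j → DkAdj (f i) (f j))
  f-adj = proj₂ (proj₂ (proj₂ (proj₂ iso)))

  noThreeNeighbours : ∀ {S} → IsDkVertex G k S → ¬ Distinct 3 (λ T → IsDkVertex G k T × DkAdj S T)
  noThreeNeighbours {S} vS with f-onto S vS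
  ... | i , refl = cycleDegree i ∘ mapDistinct index index-injective adjacent
    where
    index : ∀ T → IsDkVertex G k T × DkAdj (f i) T → Fin m
    index T (vT , _) = proj₁ (f-onto T vT)
    index-injective : ∀ {T T′} a a′ → index T a ≡ index T′ a′ → T ≡ T′
    index-injective {T} {T′} (vT , _) (vT′ , _) e =
      trans (≡.sym (proj₂ (f-onto T vT))) (trans (cong f e) (proj₂ (f-onto T′ vT′)))
    adjacent : ∀ T a → CycleAdj m i (index T a)
    adjacent T (vT , S~T) = proj₁ (f-adj i _) (subst (DkAdj (f i)) (≡.sym (proj₂ (f-onto T vT))) S~T)

  -- A TDS S with ∣ S ∣ < k has at most two vertices outside: adding any of them
  -- gives a neighbour of S in D.
  fewInsertions : ∀ {S} → IsTDS G S → suc ∣ S ∣ ≤ k → ¬ Distinct 3 (_∉ S)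
  fewInsertions {S} tds small =
    noThreeNeighbours (tds , ≤-trans (n≤1+n _) small) ∘
    mapDistinct (λ x _ → S ∪ ⁅ x ⁆) (λ x∉S _ → ∪⁅⁆-injective x∉S) grow
    where
    grow : ∀ x → x ∉ S → IsDkVertex G k (S ∪ ⁅ x ⁆) × DkAdj S (S ∪ ⁅ x ⁆)
    grow x x∉S = (tds-mono (p⊆p∪q ⁅ x ⁆) tds , subst (_≤ k) (≡.sym (∣p∪⁅x⁆∣ S x∉S)) small) , inj₁ (x , x∉S , refl)

  -- A vertex S of D has at most two members y with S - y still a TDS:
  -- each such S - y is a neighbour of S in D.
  fewDeletions : ∀ {S} → IsDkVertex G k S → ¬ Distinct 3 (λ y → y ∈ S × IsTDS G (S - y))
  fewDeletions {S} vS =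
    noThreeNeighbours vS ∘ mapDistinct (λ y _ → S - y) (λ q _ → remove-injective (proj₁ q)) delete
    where
    delete : ∀ y → y ∈ S × IsTDS G (S - y) → IsDkVertex G k (S - y) × DkAdj S (S - y)
    delete y (y∈S , tds) = (tds , ≤-trans (∣p─q∣≤∣p∣ S ⁅ y ⁆) (proj₂ vS)) , inj₂ (y , x∉p-x S y , ≡.sym (p-x∪⁅x⁆ y∈S))

  orderBound : ∀ {S} → IsTDS G S → suc ∣ S ∣ ≤ k → n ≤ 2 + ∣ S ∣
  orderBound {S} tds small with 3 + ∣ S ∣ ≤? n
  ... | yes room = contradiction (missing S room) (fewInsertions tds small)
  ... | no ¬room = ≤-pred (ℕ.≰⇒> ¬room)

  edgeBound : ∀ {A v} → IsTDS G A → v ∉ A → IsDkVertex G k (A ∪ ⁅ v ⁆) → n ≤ 2 + ∣ A ∣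
  edgeBound {A} tds v∉A (_ , size) = orderBound tds (subst (_≤ k) (∣p∪⁅x⁆∣ A v∉A) size)

  growCoSingleton : ∀ {A v} → IsTDS G A → v ∉ A → IsDkVertex G k (A ∪ ⁅ v ⁆) →
                    IsCoSingleton A ⊎ IsCoSingleton (A ∪ ⁅ v ⁆)
  growCoSingleton {A} {v} tds v∉A vB with suc ∣ A ∣ ℕ.≟ n
  ... | yes full = inj₁ (coSingleton full)
  ... | no ¬full = inj₂ (coSingleton (trans (cong suc (∣p∪⁅x⁆∣ A v∉A))
                          (ℕ.≤-antisym (ℕ.≤∧≢⇒< (outside⇒<n v∉A) ¬full) (edgeBound tds v∉A vB))))

  edgeCoSingleton : ∀ {S T} → IsDkVertex G k S → IsDkVertex G k T → DkAdj S T →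
                    IsCoSingleton S ⊎ IsCoSingleton T
  edgeCoSingleton vS vT (inj₁ (v , v∉S , refl)) = growCoSingleton (proj₁ vS) v∉S vT
  edgeCoSingleton vS vT (inj₂ (v , v∉T , refl)) = Sum.swap (growCoSingleton (proj₁ vT) v∉T vS)

  order≤1+k : 2 ≤ m → n ≤ suc k
  order≤1+k (s≤s (s≤s _)) = edgeOrder (f-vertex zero) (f-vertex (suc zero)) (proj₂ (f-adj zero (suc zero)) (inj₁ refl))
    where
    edgeOrder : ∀ {S T} → IsDkVertex G k S → IsDkVertex G k T → DkAdj S T → n ≤ suc k
    edgeOrder vS vT (inj₁ (v , v∉S , refl)) =
      ≤-trans (edgeBound (proj₁ vS) v∉S vT) (s≤s (subst (_≤ k) (∣p∪⁅x⁆∣ _ v∉S) (proj₂ vT)))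
    edgeOrder vS vT (inj₂ (v , v∉T , refl)) =
      ≤-trans (edgeBound (proj₁ vT) v∉T vS) (s≤s (subst (_≤ k) (∣p∪⁅x⁆∣ _ v∉T) (proj₂ vS)))

  -- The co-singleton vertices of D form a vertex cover of C_m, so for m ≥ 11
  -- six vertices x of G have ∁ ⁅ x ⁆ total dominating.
  sixCoSingletons : 11 ≤ m → Distinct 6 (λ x → IsTDS G (∁ ⁅ x ⁆))
  sixCoSingletons 11≤m =
    mapDistinct (λ _ → proj₁) missing-injective (λ i q → subst (IsTDS G) (proj₂ q) (proj₁ (f-vertex i)))
      (cycleCover (λ i → IsCoSingleton (f i)) (s≤s 11≤m) λ i j i~j →
         edgeCoSingleton (f-vertex i) (f-vertex j) (proj₂ (f-adj i j) i~j))
    where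
    missing-injective : ∀ {i j} (qi : IsCoSingleton (f i)) (qj : IsCoSingleton (f j)) → proj₁ qi ≡ proj₁ qj → i ≡ j
    missing-injective {i} {j} (x , eᵢ) (y , eⱼ) x≡y = f-injective i j (trans eᵢ (trans (cong (∁ ∘ ⁅_⁆) x≡y) (≡.sym eⱼ)))

  -- The support vertex of a leaf lies in every TDS, so it is none of those six.
  sevenWithLeaf : ∀ {l p} → IsLeafOf l p → 11 ≤ m → 7 ≤ n
  sevenWithLeaf {l} {p} leaf 11≤m = Distinct⇒≤ (cons {Q = U} p tt (weaken (λ _ → tt) six) p-new)
    where
    six = sixCoSingletons 11≤m
    p-new : ∀ t → pick six t ≢ p
    p-new t x≡p = x∉∁⁅x⁆ p (subst (λ x → p ∈ ∁ ⁅ x ⁆) x≡p (support∈TDS leaf (pick-sat six t)))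

  -- From now on n ≤ k + 1, so sizes no longer restrict the vertices of D.
  module Bounded (n≤1+k : n ≤ suc k) where

    properTDS : ∀ {S x} → IsTDS G S → x ∉ S → IsDkVertex G k S
    properTDS tds x∉S = tds , ≤-pred (≤-trans (outside⇒<n x∉S) n≤1+k)

    noTDSMissesThree : ∀ {S} → IsTDS G S → ¬ Distinct 3 (_∉ S)
    noTDSMissesThree tds D = fewInsertions tds (≤-trans (n≤1+n _) (≤-pred (≤-trans (missing-count D) n≤1+k))) D

    failedDeletions : ∀ {S} {Q : Pred (Fin n) 0ℓ} → IsDkVertex G k S → (∀ {y} → Q y → y ∈ S) →
                      Distinct 5 Q → ¬ ¬ Distinct 3 (Q ∩ λ y → ¬ IsTDS G (S - y))
    failedDeletions {S} {Q} vS Q⊆S candidates = do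
      tds? ← ¬¬-∀-Fin (λ y → ¬¬-excluded-middle)
      pure (pigeonhole ℕ.≤-refl tds? candidates (fewDeletions vS ∘ weaken λ { (q , tds) → Q⊆S q , tds }))

    -- G has at most two support vertices: deleting leaves of three of them
    -- would leave a TDS missing three vertices.
    noThreeSupports : ¬ Distinct 3 (λ y → ∃ λ c → IsLeafOf c y)
    noThreeSupports D =
      leafComplementTDS (image c) c (pick D) (∈image⁻ c) leaves (pick-injective D)
        λ tds → noTDSMissesThree tds (distinct c c-injective λ i ∈∁ → x∈∁p⇒x∉p ∈∁ (∈image⁺ c i))
      where
      c : Fin 3 → Fin n
      c i = proj₁ (pick-sat D i)
      leaves : ∀ i → IsLeafOf (c i) (pick D i)
      leaves i = proj₂ (pick-sat D i)
      c-injective : ∀ {s t} → c s ≡ c t → s ≡ t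
      c-injective {s} {t} e = pick-injective D (support-unique (leaves s)
                                                  (subst (λ w → IsLeafOf w (pick D t)) (≡.sym e) (leaves t)))

    module NoLeaf (noLeaf : ∀ c y → ¬ IsLeafOf c y) (6≤n : 6 ≤ n) where

      -- Each vertex x has three neighbours w, each with neighbourhood {x, y}
      -- for its own y; they block the deletions ∁ ⁅ x ⁆ - y.
      privateNeighbours : ∀ x → ¬ ¬ Distinct 3 (λ w → w ~ x × ∃ λ y → Within w x y)
      privateNeighbours x = do
        tds ← noLeaf⇒coSingletonTDS noLeaf x
        F ← failedDeletions (properTDS tds (x∉∁⁅x⁆ x)) ∈∁⁅⁆ candidates
        W ← ¬¬-∀-Fin (λ t → blocker (proj₂ (pick-sat F t)))
        pure (distinct (λ t → proj₁ (W t)) (blockers-injective F W) λ t →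
                let _ , w~x , _ , within = W t in w~x , pick F t , within)
        where
        candidates : Distinct 5 (_≢ x)
        candidates = weaken (λ y∉⁅x⁆ y≡x → y∉⁅x⁆ (subst (_∈ ⁅ x ⁆) (≡.sym y≡x) (x∈⁅x⁆ x)))
                            (missing ⁅ x ⁆ (subst (λ s → 5 + s ≤ n) (≡.sym (∣⁅x⁆∣≡1 x)) 6≤n))
        blocker : ∀ {y} → ¬ IsTDS G (∁ ⁅ x ⁆ - y) → ¬ ¬ ∃ λ w → w ~ x × w ~ y × Within w x y
        blocker ¬tds = do
          w , within ← blockedVertex ¬tds
          w~x , w~y ← nonLeafWithin (noLeaf w) within
          pure (w , w~x , w~y , within)
        blockers-injective : (F : Distinct 3 ((_≢ x) ∩ λ y → ¬ IsTDS G (∁ ⁅ x ⁆ - y)))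
                             (W : ∀ t → ∃ λ w → w ~ x × w ~ pick F t × Within w x (pick F t)) →
                             ∀ {s t} → proj₁ (W s) ≡ proj₁ (W t) → s ≡ t
        blockers-injective F W {s} {t} e =
          pick-injective F (drop-left (proj₁ (pick-sat F s)) (withinₜ _ (subst (_~ pick F s) e wₛ~yₛ)))
          where
          wₛ~yₛ = proj₁ (proj₂ (proj₂ (W s)))
          withinₜ = proj₂ (proj₂ (proj₂ (W t)))

      -- A vertex w with neighbourhood {x₀, y} cannot have three neighbours.
      impossible : ¬ ¬ Empty
      impossible = do
        D ← privateNeighbours x₀
        let _ , _ , within = pick-sat D zero
        D′ ← privateNeighbours (pick D zero)
        pure (noThreeInPair (weaken (λ q → within _ (sym G (proj₁ q))) D′))
        where
        x₀ : Fin n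
        x₀ = fromℕ< (≤-trans (s≤s z≤n) 6≤n)

    module Leaf {l p} (leaf : IsLeafOf l p) (7≤n : 7 ≤ n) where

      withoutLeaf : ¬ ¬ IsTDS G (∁ ⁅ l ⁆)
      withoutLeaf = leafComplementTDS {r = 1} ⁅ l ⁆ (λ _ → l) (λ _ → p)
        (λ v∈ → zero , x∈⁅y⁆⇒x≡y l v∈) (λ _ → leaf) λ { {zero} {zero} _ → refl }

      Candidate : Pred (Fin n) 0ℓ
      Candidate y = y ≢ l × y ≢ p

      candidates : Distinct 5 Candidate
      candidates = weaken avoid (missing (⁅ l ⁆ ∪ ⁅ p ⁆) (subst (λ s → 5 + s ≤ n) (≡.sym size) 7≤n))
        where
        p≢l : p ≢ l
        p≢l refl = irrefl G (leaf-adj leaf)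
        size : ∣ ⁅ l ⁆ ∪ ⁅ p ⁆ ∣ ≡ 2
        size = trans (∣p∪⁅x⁆∣ ⁅ l ⁆ (x≢y⇒x∉⁅y⁆ p≢l)) (cong suc (∣⁅x⁆∣≡1 l))
        avoid : ∀ {y} → y ∉ ⁅ l ⁆ ∪ ⁅ p ⁆ → Candidate y
        avoid y∉ = (λ { refl → y∉ (x∈p∪q⁺ (inj₁ (x∈⁅x⁆ l))) }) , (λ { refl → y∉ (x∈p∪q⁺ (inj₂ (x∈⁅x⁆ p))) })

      module Blocked (F : Distinct 3 (Candidate ∩ λ y → ¬ IsTDS G (∁ ⁅ l ⁆ - y)))
                     (W : ∀ t → ∃ λ w → Within w l (pick F t)) where

        w : Fin 3 → Fin n
        w t = proj₁ (W t)

        -- Two blockers adjacent to l would both equal p, and p would have no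
        -- neighbour besides l: a K₂ component.
        atMostOneAdjacent : ¬ Distinct 2 (U ∩ λ t → w t ~ l)
        atMostOneAdjacent D = noK2 l p (leaf-adj leaf) (leaf , p-leaf)
          where
          onlyNeighbour : ∀ {u} → w u ~ l → ∀ z → p ~ z → z ≡ l ⊎ z ≡ pick F u
          onlyNeighbour {u} wᵤ~l z p~z = proj₂ (W u) z (subst (_~ z) (≡.sym (leaf _ (sym G wᵤ~l))) p~z)
          p-leaf : IsLeafOf p l
          p-leaf z p~z with onlyNeighbour (proj₂ (pick-sat D zero)) z p~z
                          | onlyNeighbour (proj₂ (pick-sat D (suc zero))) z p~z
          ... | inj₁ z≡l | _ = z≡l
          ... | _ | inj₁ z≡l = z≡l
          ... | inj₂ z≡yₛ | inj₂ z≡yₜ =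
            contradiction (pick-injective F (trans (≡.sym z≡yₛ) z≡yₜ)) (distinct-picks D λ ())

        -- So two blockers are leaves of their candidates; with l they give
        -- three different support vertices.
        threeSupports : Decidable (λ t → w t ~ l) → Distinct 3 (λ y → ∃ λ c → IsLeafOf c y)
        threeSupports adjacent? =
          cons p (l , leaf) (mapDistinct (λ t _ → pick F t) (λ _ _ → pick-injective F) leafOf two)
            λ i → proj₂ (proj₁ (pick-sat F (pick two i)))
          where
          two : Distinct 2 (U ∩ Not (λ t → w t ~ l))
          two = pigeonhole ℕ.≤-refl adjacent? allOf atMostOneAdjacent
          leafOf : ∀ t → (U ∩ Not (λ t → w t ~ l)) t → ∃ λ c → IsLeafOf c (pick F t)
          leafOf t (_ , ¬wₜ~l) = w t , λ z wₜ~z →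
            drop-left (λ { refl → ¬wₜ~l wₜ~z }) (proj₂ (W t) z wₜ~z)

      impossible : ¬ ¬ Empty
      impossible = do
        tds ← withoutLeaf
        F ← failedDeletions (properTDS tds (x∉∁⁅x⁆ l)) (∈∁⁅⁆ ∘ proj₁) candidates
        W ← ¬¬-∀-Fin (λ t → blockedVertex (proj₂ (pick-sat F t)))
        adjacent? ← ¬¬-∀-Fin (λ t → ¬¬-excluded-middle)
        pure (noThreeSupports (Blocked.threeSupports F W adjacent?))

  excluded : 2 ≤ m → (∀ {l p} → IsLeafOf l p → 7 ≤ n) → ((∀ c y → ¬ IsLeafOf c y) → 6 ≤ n) → Empty
  excluded 2≤m orderWithLeaf orderWithoutLeaf = ¬¬-excluded-middle decide
    where
    open Bounded (order≤1+k 2≤m)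
    decide : ¬ Dec (∃ λ l → ∃ λ p → IsLeafOf l p)
    decide (yes (l , p , leaf)) = Leaf.impossible leaf (orderWithLeaf leaf) λ ()
    decide (no noLeaf) = NoLeaf.impossible noLeaf′ (orderWithoutLeaf noLeaf′) λ ()
      where noLeaf′ : ∀ c y → ¬ IsLeafOf c y
            noLeaf′ c y leaf = noLeaf (c , y , leaf)

proposition4p4 : (∀ (n : ℕ) (G : Graph n) → NoIsolated G → NoK2Component G → 6 < n →
    ∀ (k m : ℕ) → 3 ≤ m → ¬ DkIsoCycle G k m)
    ×
    (∀ (m : ℕ) → 10 < m → ∀ (n : ℕ) (G : Graph n) → NoIsolated G → NoK2Component G →
    ∀ (k : ℕ) → ¬ DkIsoCycle G k m)
proposition4p4 = part₁ , part₂
  where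
  part₁ : ∀ (n : ℕ) (G : Graph n) → NoIsolated G → NoK2Component G → 6 < n →
          ∀ (k m : ℕ) → 3 ≤ m → ¬ DkIsoCycle G k m
  part₁ n G noIsolated noK2 7≤n k m 3≤m iso =
    excluded (≤-trans (n≤1+n 2) 3≤m) (λ _ → 7≤n) (λ _ → ≤-trans (n≤1+n 6) 7≤n)
    where open Isomorphic G noIsolated noK2 iso
  part₂ : ∀ (m : ℕ) → 10 < m → ∀ (n : ℕ) (G : Graph n) → NoIsolated G → NoK2Component G →
          ∀ (k : ℕ) → ¬ DkIsoCycle G k m
  part₂ m 11≤m n G noIsolated noK2 k iso =
    excluded (≤-trans (s≤s (s≤s z≤n)) 11≤m) (λ leaf → sevenWithLeaf leaf 11≤m)
             (λ _ → Distinct⇒≤ (sixCoSingletons 11≤m))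
    where open Isomorphic G noIsolated noK2 iso
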